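{- Let $d\ge 3$, $n$ and $k$ be positive integers, and let $G$ be any $d$-regular graph on $n$ vertices. Then $s^{*}_{d-2+k}(G)\le 2\lceil d/k\rceil$. Consequently $s^{*}_{d-2+k}(n,d)\le 2\lceil d/k\rceil$.
   Context: For a graph $G$ and a positive integer $b$, the $(1:b)$ Maker--Breaker component game on $G$ is played as follows: two players, Maker and Breaker, alternately claim previously unclaimed (free) edges of $G$; Maker moves first, and on each move Maker claims one free edge and Breaker claims $b$ free edges (a player who cannot complete his quota claims all remaining free edges). The game ends when all edges are claimed. $s^{*}_{b}(G)$ denotes the largest integer $s$ such that Maker has a strategy guaranteeing that, at the end of the $(1:b)$ game on $G$, the graph formed by Maker's edges has a connected component with at least $s$ vertices. For $d\ge 3$, $s^{*}_{b}(n,d)=\max\{s^{*}_{b}(G): G \text{ is a } d\text{ -regular graph on } n \text{ vertices}\}$. -}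

module Defs where

open import Data.Nat using (ℕ; zero; suc; _+_; _*_; _∸_; _≤_; _<_; NonZero; >-nonZero)
open import Data.Nat.DivMod using (_/_)
open import Data.Fin using (Fin; toℕ)
open import Data.List using (List; []; _∷_; length; lookup; removeAt)
open import Data.List.Relation.Unary.All using (All)
open import Data.List.Relation.Unary.Unique.Propositional using (Unique)
open import Data.List.Membership.Propositional using (_∈_)
open import Data.Product using (_×_; _,_; ∃)
open import Data.Sum using (_⊎_)
open import Relation.Binary.PropositionalEquality using (_≡_)
open import Relation.Nullary using (yes; no)
open import Data.Fin using (_≟_)

Edge : ℕ → Set
Edge n = Fin n × Fin n

-- A finite simple graph on vertex set Fin n: a duplicate-free list of edges {u,v},
-- each stored once as (u , v) with u < v (so no loops, no multi-edges).
record SimpleGraph (n : ℕ) : Set where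
  field
    edges   : List (Edge n)
    ordered : All (λ e → toℕ (Data.Product.proj₁ e) < toℕ (Data.Product.proj₂ e)) edges
    unique  : Unique edges
open SimpleGraph public

incidences : ∀ {n} → Fin n → List (Edge n) → ℕ
incidences v [] = 0
incidences v ((a , b) ∷ es) with a ≟ v | b ≟ v
... | yes _ | _     = suc (incidences v es)
... | no _  | yes _ = suc (incidences v es)
... | no _  | no _  = incidences v es

degree : ∀ {n} → SimpleGraph n → Fin n → ℕ
degree G v = incidences v (edges G)

Regular : ∀ {n} → SimpleGraph n → ℕ → Set
Regular G d = ∀ v → degree G v ≡ d

data Reach {n : ℕ} (M : List (Edge n)) : Fin n → Fin n → Set where
  here : ∀ {v} → Reach M v v
  step : ∀ {u v w} → ((u , v) ∈ M ⊎ (v , u) ∈ M) → Reach M v w → Reach M u w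

HasComponentAtLeast : ∀ {n} → List (Edge n) → ℕ → Set
HasComponentAtLeast {n} M s =
  ∃ λ (v : Fin n) → ∃ λ (vs : List (Fin n)) →
    Unique vs × All (Reach M v) vs × s ≤ length vs

-- MakerWins b Goal F M : it is Maker's turn, F is the list of free edges,
--   M the list of Maker's edges, and Maker has a strategy ensuring that
--   Goal holds for Maker's final edge set.
-- BreakerTurn b Goal j F M : Breaker still has to claim j edges in the current
--   turn (claiming a set of b edges is modelled as b consecutive single claims,
--   Maker not moving in between); if edges run out, Breaker claims all remaining.
mutual
  data MakerWins (b : ℕ) {n : ℕ} (Goal : List (Edge n) → Set)
       : List (Edge n) → List (Edge n) → Set where
    finished : ∀ {M} → Goal M → MakerWins b Goal [] M
    claim    : ∀ {F M} (i : Fin (length F)) →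
               BreakerTurn b Goal b (removeAt F i) (lookup F i ∷ M) →
               MakerWins b Goal F M

  data BreakerTurn (b : ℕ) {n : ℕ} (Goal : List (Edge n) → Set)
       : ℕ → List (Edge n) → List (Edge n) → Set where
    turnDone  : ∀ {F M} → MakerWins b Goal F M → BreakerTurn b Goal 0 F M
    exhausted : ∀ {j M} → MakerWins b Goal [] M → BreakerTurn b Goal (suc j) [] M
    respond   : ∀ {j e F M} →
                ((i : Fin (length (e ∷ F))) →
                   BreakerTurn b Goal j (removeAt (e ∷ F) i) M) →
                BreakerTurn b Goal (suc j) (e ∷ F) M

MakerCanForceComponent : ∀ {n} → SimpleGraph n → (b s : ℕ) → Set
MakerCanForceComponent G b s = MakerWins b (λ M → HasComponentAtLeast M s) (edges G) []

ceilDiv : ℕ → (k : ℕ) → 1 ≤ k → ℕ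
ceilDiv d k hk = _/_ (d + k ∸ 1) k {{>-nonZero hk}}

-- Breaker maintains a labelling of the vertices whose classes are unions of Maker's
-- components, with at most one vertex per class still incident to free edges; if
-- that vertex has f free edges and its class c vertices, then k c + f ≤ d + k.
-- In particular a class that can still grow has c ≤ ⌈d/k⌉.  When Maker claims pq,
-- joining the classes of p and q, the two budgets give
-- k (c_p + c_q) + f_p + f_q ≤ 2(d + k) - 2, so by spending his d - 2 + k edges
-- first on the free edges at q and then on those at p, Breaker restores the
-- invariant for the merged class.  Hence a class only grows by joining two classes
-- of at most ⌈d/k⌉ vertices, and no Maker component exceeds 2⌈d/k⌉.
module Submission where

open import Defs
open import Data.Fin using (Fin; _≟_)
open import Data.List using (List; []; _∷_; [_]; _++_; length; lookup; removeAt; filter; allFin)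
open import Data.List.Membership.Propositional using (_∈_)
open import Data.List.Membership.Propositional.Properties
  using (∈-filter⁺; ∈-filter⁻; ∈-allFin; ∈-++⁺ˡ; ∈-++⁺ʳ)
open import Data.List.Properties using (length-++; length-removeAt′)
open import Data.List.Relation.Binary.Subset.Propositional using (_⊆_)
open import Data.List.Relation.Unary.All as All using (All; []; _∷_)
open import Data.List.Relation.Unary.AllPairs using ([]; _∷_)
open import Data.List.Relation.Unary.Any using (here; there; index; _─_)
open import Data.List.Relation.Unary.Unique.Propositional using (Unique)
open import Data.List.Relation.Unary.Unique.Propositional.Properties
  using (allFin⁺) renaming (filter⁺ to unique-filter)
open import Data.Nat using (ℕ; zero; suc; _+_; _*_; _∸_; _≤_; _<_; z≤n; s≤s; _<?_; >-nonZero)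
open import Data.Nat.DivMod using (m*n/n≡m; /-monoˡ-≤)
open import Data.Nat.Properties hiding (_≟_)
open import Algebra.Properties.CommutativeSemigroup +-commutativeSemigroup using (x∙yz≈y∙xz)
open import Data.Nat.Solver using (module +-*-Solver)
open import Data.Product using (Σ; ∃; _,_; proj₁; proj₂)
open import Data.Sum as Sum using (_⊎_; inj₁; inj₂)
open import Data.Empty using (⊥-elim)
open import Function using (id)
open import Relation.Binary.PropositionalEquality
  using (_≡_; _≢_; refl; sym; trans; cong; subst; subst₂; ≢-sym; module ≡-Reasoning)
open import Relation.Nullary using (¬_; Dec; yes; no; contradiction)
open import Relation.Nullary.Decidable using (_⊎-dec_)
open import Relation.Unary using (Decidable)

∈-─ : ∀ {a} {A : Set a} {x y : A} {ys : List A} (x∈ys : x ∈ ys) →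
      y ∈ ys → y ≢ x → y ∈ (ys ─ x∈ys)
∈-─ (here refl) (here refl) y≢x = ⊥-elim (y≢x refl)
∈-─ (here refl) (there y∈ys) _ = y∈ys
∈-─ (there x∈ys) (here refl) _ = here refl
∈-─ (there x∈ys) (there y∈ys) y≢x = there (∈-─ x∈ys y∈ys y≢x)

unique-⊆⇒length≤ : ∀ {a} {A : Set a} {xs ys : List A} →
                   Unique xs → xs ⊆ ys → length xs ≤ length ys
unique-⊆⇒length≤ {xs = []} _ _ = z≤n
unique-⊆⇒length≤ {xs = x ∷ xs} {ys} (x∉xs ∷ unique) xs⊆ys = begin
  suc (length xs)          ≤⟨ s≤s (unique-⊆⇒length≤ unique xs⊆ys─x) ⟩
  suc (length (ys ─ x∈ys)) ≡⟨ length-removeAt′ ys (index x∈ys) ⟨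
  length ys                ∎
  where
  open ≤-Reasoning
  x∈ys = xs⊆ys (here refl)
  xs⊆ys─x : xs ⊆ (ys ─ x∈ys)
  xs⊆ys─x y∈xs = ∈-─ x∈ys (xs⊆ys (there y∈xs)) (≢-sym (All.lookup x∉xs y∈xs))

module _ {n : ℕ} where

  card : {P : Fin n → Set} → Decidable P → ℕ
  card P? = length (filter P? (allFin n))

  module _ {P : Fin n → Set} (P? : Decidable P) where

    length≤card : ∀ {vs} → Unique vs → All P vs → length vs ≤ card P?
    length≤card unique Pvs =
      unique-⊆⇒length≤ unique (λ v∈vs → ∈-filter⁺ P? (∈-allFin _) (All.lookup Pvs v∈vs))

    card≤length : ∀ {ys} → (∀ {x} → P x → x ∈ ys) → card P? ≤ length ys
    card≤length P⊆ys =
      unique-⊆⇒length≤ (unique-filter P? (allFin⁺ n)) (λ x∈ → P⊆ys (proj₂ (∈-filter⁻ P? {xs = allFin n} x∈)))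

    card-mono : {Q : Fin n → Set} (Q? : Decidable Q) → (∀ {x} → P x → Q x) → card P? ≤ card Q?
    card-mono Q? P⇒Q = card≤length (λ Px → ∈-filter⁺ Q? (∈-allFin _) (P⇒Q Px))

    card-∪ : {Q R : Fin n → Set} (Q? : Decidable Q) (R? : Decidable R) →
             (∀ {x} → P x → Q x ⊎ R x) → card P? ≤ card Q? + card R?
    card-∪ Q? R? P⇒Q∪R = subst (card P? ≤_) (length-++ (filter Q? (allFin n))) (card≤length listed)
      where
      listed : ∀ {x} → P x → x ∈ filter Q? (allFin n) ++ filter R? (allFin n)
      listed Px = Sum.[ (λ Qx → ∈-++⁺ˡ (∈-filter⁺ Q? (∈-allFin _) Qx))
                      , (λ Rx → ∈-++⁺ʳ _ (∈-filter⁺ R? (∈-allFin _) Rx)) ] (P⇒Q∪R Px)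

  classSize : (Fin n → Fin n) → Fin n → ℕ
  classSize L c = card (λ w → L w ≟ c)

  classSize-own : (L : Fin n → Fin n) (w : Fin n) → 1 ≤ classSize L (L w)
  classSize-own L w = length≤card (λ x → L x ≟ L w) ([] ∷ []) (refl ∷ [])

  classSize-id : (w : Fin n) → classSize id w ≤ 1
  classSize-id w = card≤length (λ x → x ≟ w) {[ w ]} here

  Respects : (Fin n → Fin n) → List (Edge n) → Set
  Respects L M = All (λ e → L (proj₁ e) ≡ L (proj₂ e)) M

  reach-respects : ∀ {L M u w} → Respects L M → Reach M u w → L w ≡ L u
  reach-respects resp here = refl
  reach-respects resp (step (inj₁ uv∈M) reach) = trans (reach-respects resp reach) (sym (All.lookup resp uv∈M))
  reach-respects resp (step (inj₂ vu∈M) reach) = trans (reach-respects resp reach) (All.lookup resp vu∈M)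

  component-bound : ∀ {L M s m} → Respects L M → (∀ w → classSize L (L w) ≤ m) →
                    HasComponentAtLeast M s → s ≤ m
  component-bound {L} resp small (v , vs , unique , reach , s≤|vs|) =
    ≤-trans s≤|vs| (≤-trans (length≤card (λ w → L w ≟ L v) unique (All.map (reach-respects resp) reach))
                            (small v))

  Active : Fin n → List (Edge n) → Set
  Active v F = 0 < incidences v F

  incidences-∷ : (v : Fin n) (e : Edge n) (F : List (Edge n)) →
                 incidences v (e ∷ F) ≡ incidences v [ e ] + incidences v F
  incidences-∷ v (a , b) F with a ≟ v | b ≟ v
  ... | yes _ | _     = refl
  ... | no _  | yes _ = refl
  ... | no _  | no _  = refl

  incidences-∷-skip : (v : Fin n) (e : Edge n) (G : List (Edge n)) →
                      incidences v [ e ] ≡ 0 → incidences v (e ∷ G) ≡ incidences v G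
  incidences-∷-skip v e G eq = trans (incidences-∷ v e G) (cong (_+ incidences v G) eq)

  incidences-removeAt : (v : Fin n) (F : List (Edge n)) (i : Fin (length F)) →
    incidences v F ≡ incidences v [ lookup F i ] + incidences v (removeAt F i)
  incidences-removeAt v (e ∷ F) Fin.zero = incidences-∷ v e F
  incidences-removeAt v (e ∷ F) (Fin.suc i) = begin
    incidences v (e ∷ F)                          ≡⟨ incidences-∷ v e F ⟩
    incidences v [ e ] + incidences v F           ≡⟨ cong (incidences v [ e ] +_) (incidences-removeAt v F i) ⟩
    incidences v [ e ] + (incidences v [ lookup F i ] + incidences v (removeAt F i))
      ≡⟨ x∙yz≈y∙xz (incidences v [ e ]) (incidences v [ lookup F i ]) (incidences v (removeAt F i)) ⟩
    incidences v [ lookup F i ] + (incidences v [ e ] + incidences v (removeAt F i))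
      ≡⟨ cong (incidences v [ lookup F i ] +_) (incidences-∷ v e (removeAt F i)) ⟨
    incidences v [ lookup F i ] + incidences v (e ∷ removeAt F i) ∎
    where open ≡-Reasoning

  incidences-removeAt-≤ : (v : Fin n) (F : List (Edge n)) (i : Fin (length F)) →
                          incidences v (removeAt F i) ≤ incidences v F
  incidences-removeAt-≤ v F i =
    subst (incidences v (removeAt F i) ≤_) (sym (incidences-removeAt v F i)) (m≤n+m _ _)

  active-removeAt : ∀ {v} F (i : Fin (length F)) → Active v (removeAt F i) → Active v F
  active-removeAt F i active = ≤-trans active (incidences-removeAt-≤ _ F i)

  incidences-fst : (a b : Fin n) → incidences a [ (a , b) ] ≡ 1
  incidences-fst a b with a ≟ a
  ... | yes _ = refl
  ... | no a≢a = contradiction refl a≢a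

  incidences-snd : (a b : Fin n) → incidences b [ (a , b) ] ≡ 1
  incidences-snd a b with a ≟ b | b ≟ b
  ... | yes _ | _     = refl
  ... | no _  | yes _ = refl
  ... | no _  | no b≢b = contradiction refl b≢b

  claim-incident : (v : Fin n) (F : List (Edge n)) → Active v F →
                   ∃ λ (i : Fin (length F)) → incidences v (removeAt F i) < incidences v F
  claim-incident v (e ∷ F) active with incidences v [ e ] in eq
  ... | suc m = Fin.zero , subst (suc (incidences v F) ≤_) (sym (trans (incidences-∷ v e F) (cong (_+ _) eq)))
                                 (s≤s (m≤n+m _ m))
  ... | zero with claim-incident v F (subst (0 <_) (incidences-∷-skip v e F eq) active)
  ... | i , dropped =
    Fin.suc i , subst₂ _<_ (sym (incidences-∷-skip v e _ eq)) (sym (incidences-∷-skip v e F eq)) dropped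

  redirect : (from to c : Fin n) → Fin n
  redirect from to c with c ≟ from
  ... | yes _ = to
  ... | no  _ = c

  merge : (Fin n → Fin n) → (p q w : Fin n) → Fin n
  merge L p q w = redirect (L q) (L p) (L w)

  Merged : (Fin n → Fin n) → (p q w : Fin n) → Set
  Merged L p q w = L w ≡ L p ⊎ L w ≡ L q

  module _ (L : Fin n → Fin n) (p q : Fin n) where

    merged? : ∀ w → Dec (Merged L p q w)
    merged? w = (L w ≟ L p) ⊎-dec (L w ≟ L q)

    merge-respects : ∀ {M} → Respects L M → Respects (merge L p q) M
    merge-respects = All.map (cong (redirect (L q) (L p)))

    merge-merged : ∀ {w} → Merged L p q w → merge L p q w ≡ L p
    merge-merged {w} merged with L w ≟ L q | merged
    ... | yes _ | _ = refl
    ... | no _  | inj₁ Lw≡Lp = Lw≡Lp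
    ... | no Lw≢Lq | inj₂ Lw≡Lq = contradiction Lw≡Lq Lw≢Lq

    merge-unmerged : ∀ {w} → ¬ Merged L p q w → merge L p q w ≡ L w
    merge-unmerged {w} unmerged with L w ≟ L q
    ... | yes Lw≡Lq = contradiction (inj₂ Lw≡Lq) unmerged
    ... | no _ = refl

    merge-fibre : ∀ {u} → merge L p q u ≡ L p → Merged L p q u
    merge-fibre {u} eq with L u ≟ L q
    ... | yes Lu≡Lq = inj₂ Lu≡Lq
    ... | no _ = inj₁ eq

    merge-fibre-unmerged : ∀ {u w} → ¬ Merged L p q w → merge L p q u ≡ merge L p q w → L u ≡ L w
    merge-fibre-unmerged {u} {w} unmerged eq with L u ≟ L q
    ... | yes _ = contradiction (inj₁ (sym (trans eq (merge-unmerged unmerged)))) unmerged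
    ... | no _ = trans eq (merge-unmerged unmerged)

    classSize-merged : classSize (merge L p q) (L p) ≤ classSize L (L p) + classSize L (L q)
    classSize-merged = card-∪ (λ x → merge L p q x ≟ L p) (λ x → L x ≟ L p) (λ x → L x ≟ L q) merge-fibre

    classSize-unmerged : ∀ {w} → ¬ Merged L p q w →
                         classSize (merge L p q) (merge L p q w) ≤ classSize L (L w)
    classSize-unmerged unmerged =
      card-mono (λ x → merge L p q x ≟ merge L p q _) (λ x → L x ≟ L _) (merge-fibre-unmerged unmerged)

≤-ceilDiv : ∀ {d k c} (1≤k : 1 ≤ k) → k * c < d + k → c ≤ ceilDiv d k 1≤k
≤-ceilDiv {d} {k} {c} 1≤k kc<d+k = subst (_≤ ceilDiv d k 1≤k) (m*n/n≡m c k) (/-monoˡ-≤ k ck≤d+k-1)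
  where
  instance _ = >-nonZero 1≤k
  ck≤d+k-1 : c * k ≤ d + k ∸ 1
  ck≤d+k-1 = m+n≤o⇒m≤o∸n (c * k) (subst (_≤ d + k) (trans (+-comm 1 (k * c)) (cong (_+ 1) (*-comm k c))) kc<d+k)

quota-single : ∀ {d k c f} → 2 ≤ d → 1 ≤ k → 1 ≤ c → k * c + suc f ≤ d + k → f ≤ d ∸ 2 + k
quota-single {suc (suc d)} {suc k} {c} {f} (s≤s (s≤s _)) _ 1≤c budget = ≤-trans (≤-pred suc-f≤d) d+1≤d+k
  where
  k≤kc : suc k ≤ suc k * c
  k≤kc = ≤-trans (≤-reflexive (sym (*-identityʳ (suc k)))) (*-monoʳ-≤ (suc k) 1≤c)
  suc-f≤d : suc f ≤ suc (suc d)
  suc-f≤d = +-cancelʳ-≤ (suc k) (suc f) _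
    (subst (_≤ suc (suc d) + suc k) (+-comm (suc k) (suc f)) (≤-trans (+-monoˡ-≤ (suc f) k≤kc) budget))
  d+1≤d+k : suc d ≤ d + suc k
  d+1≤d+k = subst (suc d ≤_) (sym (+-suc d k)) (s≤s (m≤m+n d k))

quota-pair : ∀ {d k c c′ f f′} → 2 ≤ d → k * c + suc f ≤ d + k → k * c′ + suc f′ ≤ d + k →
             f + f′ + k * (c + c′) ≤ d + k + (d ∸ 2 + k)
quota-pair {suc (suc d)} {k} {c} {c′} {f} {f′} (s≤s (s≤s _)) budget budget′ =
  ≤-pred (≤-pred (subst₂ _≤_ lhs rhs (+-mono-≤ budget budget′)))
  where
  open +-*-Solver
  lhs : k * c + suc f + (k * c′ + suc f′) ≡ 2 + (f + f′ + k * (c + c′))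
  lhs = solve 5 (λ k c c′ f f′ → k :* c :+ (con 1 :+ f) :+ (k :* c′ :+ (con 1 :+ f′))
                                := con 2 :+ (f :+ f′ :+ k :* (c :+ c′))) refl k c c′ f f′
  rhs : 2 + d + k + (2 + d + k) ≡ 2 + (2 + d + k + (d + k))
  rhs = solve 2 (λ d k → con 2 :+ d :+ k :+ (con 2 :+ d :+ k) := con 2 :+ (con 2 :+ d :+ k :+ (d :+ k))) refl d k

quota-step : ∀ {a a′ K X j} → a′ < a → a + K ≤ X + suc j → a′ + K ≤ X + j
quota-step {a} {a′} {K} {X} {j} a′<a within =
  ≤-pred (≤-trans (+-monoˡ-≤ K a′<a) (subst (a + K ≤_) (+-suc X j) within))

-- Position holds whenever Maker is to move, Midturn j while Breaker still has j
-- edges to claim in the current turn.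
record BreakerStrategy {n : ℕ} (b : ℕ) (Goal : List (Edge n) → Set) : Set₁ where
  field
    Position     : List (Edge n) → List (Edge n) → Set
    Midturn      : ℕ → List (Edge n) → List (Edge n) → Set
    turn-start   : ∀ {F M} → Position F M → (i : Fin (length F)) →
                   Midturn b (removeAt F i) (lookup F i ∷ M)
    next-claim   : ∀ {j e F M} → Midturn (suc j) (e ∷ F) M →
                   Σ (Fin (length (e ∷ F))) λ i → Midturn j (removeAt (e ∷ F) i) M
    turn-end     : ∀ {F M} → Midturn 0 F M → Position F M
    out-of-edges : ∀ {j M} → Midturn j [] M → Position [] M
    blocks-goal  : ∀ {M} → Position [] M → ¬ Goal M

  mutual
    defeats : ∀ {F M} → Position F M → ¬ MakerWins b Goal F M
    defeats position (finished goal) = blocks-goal position goal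
    defeats position (claim i turn)  = defeats-turn (turn-start position i) turn

    defeats-turn : ∀ {j F M} → Midturn j F M → ¬ BreakerTurn b Goal j F M
    defeats-turn midturn (turnDone play)  = defeats (turn-end midturn) play
    defeats-turn midturn (exhausted play) = defeats (out-of-edges midturn) play
    defeats-turn midturn (respond replies) with next-claim midturn
    ... | i , midturn′ = defeats-turn midturn′ (replies i)

module ComponentStrategy {n : ℕ} (d k : ℕ) (2≤d : 2 ≤ d) (1≤k : 1 ≤ k) where

  t : ℕ
  t = ceilDiv d k 1≤k

  record Safe (L : Fin n → Fin n) (F M : List (Edge n)) : Set where
    field
      respects : Respects L M
      small    : ∀ w → classSize L (L w) ≤ 2 * t
      budget   : ∀ w → Active w F → k * classSize L (L w) + incidences w F ≤ d + k
      lone     : ∀ u w → Active u F → Active w F → L u ≡ L w → u ≡ w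

  -- Breaker's state after Maker joined the classes of p and q under L, before Breaker
  -- has finished his turn; only the merged class may violate the invariant.
  record Merging (j : ℕ) (F M : List (Edge n)) : Set where
    field
      L             : Fin n → Fin n
      p q           : Fin n
      respects      : Respects (merge L p q) M
      small         : ∀ w → classSize (merge L p q) (merge L p q w) ≤ 2 * t
      lone          : ∀ u w → Active u F → Active w F → L u ≡ L w → u ≡ w
      budget        : ∀ w → ¬ Merged L p q w → Active w F → k * classSize L (L w) + incidences w F ≤ d + k
      merged-active : ∀ u → Merged L p q u → Active u F → u ≡ p ⊎ u ≡ q
      q-quota       : incidences q F ≤ j
      p-quota       : Active p F →
                      incidences p F + incidences q F + k * (classSize L (L p) + classSize L (L q)) ≤ d + k + j

  start : (G : SimpleGraph n) → Regular G d → Safe id (edges G) []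
  start G regular = record
    { respects = []
    ; small    = λ w → ≤-trans (classSize-id w) 1≤2t
    ; budget   = λ w _ → subst (λ f → k * classSize id w + f ≤ d + k) (sym (regular w)) (singleton-budget w)
    ; lone     = λ u w _ _ u≡w → u≡w
    }
    where
    1≤2t : 1 ≤ 2 * t
    1≤2t = ≤-trans (≤-ceilDiv 1≤k (subst (_< d + k) (sym (*-identityʳ k)) (m<n+m k (≤-trans (s≤s z≤n) 2≤d))))
                   (m≤m+n t (t + 0))
    singleton-budget : ∀ w → k * classSize id w + d ≤ d + k
    singleton-budget w = ≤-trans (+-monoˡ-≤ d (≤-trans (*-monoʳ-≤ k (classSize-id w)) (≤-reflexive (*-identityʳ k))))
                                 (≤-reflexive (+-comm k d))

  classSize≤t : ∀ {L F M w} → Safe L F M → Active w F → classSize L (L w) ≤ t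
  classSize≤t {L} {w = w} safe active =
    ≤-ceilDiv 1≤k (<-≤-trans (m<m+n (k * classSize L (L w)) active) (Safe.budget safe w active))

  maker-joins : ∀ {L F M} → Safe L F M → (i : Fin (length F)) →
                Merging (d ∸ 2 + k) (removeAt F i) (lookup F i ∷ M)
  maker-joins {L} {F} {M} safe i = record
    { L             = L
    ; p             = p
    ; q             = q
    ; respects      = trans (merge-merged L p q (inj₁ refl)) (sym (merge-merged L p q (inj₂ refl)))
                      ∷ merge-respects L p q respects
    ; small         = small′
    ; lone          = λ u w au aw → lone u w (active-removeAt F i au) (active-removeAt F i aw)
    ; budget        = λ w _ aw → ≤-trans (+-monoʳ-≤ _ (incidences-removeAt-≤ w F i))
                                         (budget w (active-removeAt F i aw))
    ; merged-active = merged-active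
    ; q-quota       = quota-single 2≤d 1≤k (classSize-own L q) q-budget
    ; p-quota       = λ _ → quota-pair 2≤d p-budget q-budget
    }
    where
    open Safe safe
    p q : Fin n
    p = proj₁ (lookup F i)
    q = proj₂ (lookup F i)
    p-drops : incidences p F ≡ suc (incidences p (removeAt F i))
    p-drops = trans (incidences-removeAt p F i) (cong (_+ incidences p (removeAt F i)) (incidences-fst p q))
    q-drops : incidences q F ≡ suc (incidences q (removeAt F i))
    q-drops = trans (incidences-removeAt q F i) (cong (_+ incidences q (removeAt F i)) (incidences-snd p q))
    p-active : Active p F
    p-active = subst (0 <_) (sym p-drops) (s≤s z≤n)
    q-active : Active q F
    q-active = subst (0 <_) (sym q-drops) (s≤s z≤n)
    p-budget : k * classSize L (L p) + suc (incidences p (removeAt F i)) ≤ d + k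
    p-budget = subst (λ f → k * classSize L (L p) + f ≤ d + k) p-drops (budget p p-active)
    q-budget : k * classSize L (L q) + suc (incidences q (removeAt F i)) ≤ d + k
    q-budget = subst (λ f → k * classSize L (L q) + f ≤ d + k) q-drops (budget q q-active)
    merged-active : ∀ u → Merged L p q u → Active u (removeAt F i) → u ≡ p ⊎ u ≡ q
    merged-active u (inj₁ Lu≡Lp) active = inj₁ (lone u p (active-removeAt F i active) p-active Lu≡Lp)
    merged-active u (inj₂ Lu≡Lq) active = inj₂ (lone u q (active-removeAt F i active) q-active Lu≡Lq)
    merged-small : classSize (merge L p q) (L p) ≤ 2 * t
    merged-small = ≤-trans (classSize-merged L p q)
      (≤-trans (+-mono-≤ (classSize≤t safe p-active) (classSize≤t safe q-active))
               (≤-reflexive (cong (t +_) (sym (+-identityʳ t)))))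
    small′ : ∀ w → classSize (merge L p q) (merge L p q w) ≤ 2 * t
    small′ w with merged? L p q w
    ... | yes merged =
      subst (λ c → classSize (merge L p q) c ≤ 2 * t) (sym (merge-merged L p q merged)) merged-small
    ... | no unmerged = ≤-trans (classSize-unmerged L p q unmerged) (small w)

  module _ {j e F M} (merging : Merging (suc j) (e ∷ F) M) where
    open Merging merging

    private
      claim-at : (i : Fin (suc (length F))) → let F′ = removeAt (e ∷ F) i in
                 incidences q F′ ≤ j →
                 (Active p F′ → incidences p F′ + incidences q F′ < incidences p (e ∷ F) + incidences q (e ∷ F)) →
                 Merging j F′ M
      claim-at i q-quota′ progress = record
        { L             = L
        ; p             = p
        ; q             = q
        ; respects      = respects
        ; small         = small
        ; lone          = λ u w au aw → lone u w (active-removeAt (e ∷ F) i au) (active-removeAt (e ∷ F) i aw)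
        ; budget        = λ w unmerged aw → ≤-trans (+-monoʳ-≤ _ (incidences-removeAt-≤ w (e ∷ F) i))
                                                     (budget w unmerged (active-removeAt (e ∷ F) i aw))
        ; merged-active = λ u merged a → merged-active u merged (active-removeAt (e ∷ F) i a)
        ; q-quota       = q-quota′
        ; p-quota       = λ a → quota-step (progress a) (p-quota (active-removeAt (e ∷ F) i a))
        }

      q-stays-idle : ¬ Active q (e ∷ F) → ∀ i → incidences q (removeAt (e ∷ F) i) ≤ j
      q-stays-idle q-idle i = ≤-trans (incidences-removeAt-≤ q (e ∷ F) i) (≤-trans (≮⇒≥ q-idle) z≤n)

    breaker-claims : Σ (Fin (length (e ∷ F))) λ i → Merging j (removeAt (e ∷ F) i) M
    breaker-claims with 0 <? incidences q (e ∷ F) | 0 <? incidences p (e ∷ F)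
    ... | yes q-active | _ with claim-incident q (e ∷ F) q-active
    ... | i , q-drops = i , claim-at i (≤-pred (≤-trans q-drops q-quota))
                                     (λ _ → +-mono-≤-< (incidences-removeAt-≤ p (e ∷ F) i) q-drops)
    breaker-claims | no q-idle | yes p-active with claim-incident p (e ∷ F) p-active
    ... | i , p-drops = i , claim-at i (q-stays-idle q-idle i)
                                     (λ _ → +-mono-<-≤ p-drops (incidences-removeAt-≤ q (e ∷ F) i))
    breaker-claims | no q-idle | no p-idle =
      Fin.zero , claim-at Fin.zero (q-stays-idle q-idle Fin.zero)
                          (λ a → contradiction (active-removeAt (e ∷ F) Fin.zero a) p-idle)

  module _ {F M} (merging : Merging 0 F M) where
    open Merging merging

    private
      q-dead : incidences q F ≡ 0
      q-dead = n≤0⇒n≡0 q-quota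

      merged-is-p : ∀ u → Merged L p q u → Active u F → u ≡ p
      merged-is-p u merged active with merged-active u merged active
      ... | inj₁ u≡p = u≡p
      ... | inj₂ refl = contradiction q-quota (<⇒≱ active)

      p-budget : Active p F → k * classSize (merge L p q) (merge L p q p) + incidences p F ≤ d + k
      p-budget active = begin
        k * classSize L′ (L′ p) + fp  ≡⟨ cong (λ c → k * classSize L′ c + fp) (merge-merged L p q (inj₁ refl)) ⟩
        k * classSize L′ (L p) + fp   ≤⟨ +-monoˡ-≤ fp (*-monoʳ-≤ k (classSize-merged L p q)) ⟩
        k * (cp + cq) + fp            ≡⟨ +-comm _ fp ⟩
        fp + k * (cp + cq)            ≡⟨ cong (_+ k * (cp + cq)) (trans (cong (fp +_) q-dead) (+-identityʳ fp)) ⟨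
        fp + incidences q F + k * (cp + cq) ≤⟨ p-quota active ⟩
        d + k + 0                     ≡⟨ +-identityʳ (d + k) ⟩
        d + k                         ∎
        where
        open ≤-Reasoning
        L′ = merge L p q
        fp = incidences p F
        cp = classSize L (L p)
        cq = classSize L (L q)

    merge-completed : Safe (merge L p q) F M
    merge-completed = record
      { respects = respects
      ; small    = small
      ; budget   = budget′
      ; lone     = lone′
      }
      where
      budget′ : ∀ w → Active w F → k * classSize (merge L p q) (merge L p q w) + incidences w F ≤ d + k
      budget′ w active with merged? L p q w
      ... | no unmerged =
        ≤-trans (+-monoˡ-≤ _ (*-monoʳ-≤ k (classSize-unmerged L p q unmerged))) (budget w unmerged active)
      ... | yes merged with merged-is-p w merged active
      ... | refl = p-budget active
      lone′ : ∀ u w → Active u F → Active w F → merge L p q u ≡ merge L p q w → u ≡ w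
      lone′ u w au aw eq with merged? L p q w
      ... | yes merged = trans (merged-is-p u (merge-fibre L p q (trans eq (merge-merged L p q merged))) au)
                               (sym (merged-is-p w merged aw))
      ... | no unmerged = lone u w au aw (merge-fibre-unmerged L p q unmerged eq)

  merge-exhausted : ∀ {j M} (merging : Merging j [] M) →
                    let open Merging merging in Safe (merge L p q) [] M
  merge-exhausted merging = record
    { respects = respects
    ; small    = small
    ; budget   = λ _ ()
    ; lone     = λ _ _ ()
    }
    where open Merging merging

  breaker-strategy : (s : ℕ) → 2 * t < s → BreakerStrategy (d ∸ 2 + k) (λ M → HasComponentAtLeast M s)
  breaker-strategy s 2t<s = record
    { Position     = λ F M → ∃ λ L → Safe L F M
    ; Midturn      = Merging
    ; turn-start   = λ (_ , safe) → maker-joins safe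
    ; next-claim   = breaker-claims
    ; turn-end     = λ merging → _ , merge-completed merging
    ; out-of-edges = λ merging → _ , merge-exhausted merging
    ; blocks-goal  = λ (_ , safe) component →
                     <⇒≱ 2t<s (component-bound (Safe.respects safe) (Safe.small safe) component)
    }

-- The strategy only needs d ≥ 2.
proposition1p1 : (d n k : ℕ) → 3 ≤ d → 1 ≤ n → (hk : 1 ≤ k) →
    (G : SimpleGraph n) → Regular G d →
    (s : ℕ) → MakerCanForceComponent G (d ∸ 2 + k) s → s ≤ 2 * ceilDiv d k hk
proposition1p1 d n k 3≤d _ hk G regular s maker-wins =
  ≮⇒≥ λ 2t<s → BreakerStrategy.defeats (breaker-strategy s 2t<s) (id , start G regular) maker-wins
  where open ComponentStrategy {n} d k (≤-trans (n≤1+n 2) 3≤d) hk
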